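{- Let $C$ be a cycle and let $S_0,S_1,\dots,S_k$ be a partition of $V(C)$ with $|S_0|$ even and $k\ge 2$ ($S_0$ possibly empty, $S_1,\dots,S_k$ nonempty), and let $M$ be a perfect matching on the vertex set $S_0$ (its edges may or may not be edges of $C$). Consider the connector $C\cup M$. Then for every $i\in\{1,\dots,k\}$ there exists an $M$-augmenting path in $C\cup M$ from a vertex $v\in S_i$ to a vertex $u\in S_j$ for some $j\ne i$.
   Context: The graph $C\cup M$ (possibly with parallel edges) is called a connector; the sets $S_1,\dots,S_k$ are its terminal sets. The vertices in $S_1\cup\dots\cup S_k$ are exactly the $M$-exposed vertices. An $M$-augmenting path is a path whose edges alternately lie outside and inside $M$ and whose two endpoints are $M$-exposed (so it starts and ends with edges not in $M$). -}

module Defs where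

open import Data.Nat using (ℕ; zero; suc; _+_; _*_; _≤_; _<_)
open import Data.Fin using (Fin; toℕ)
open import Data.Fin.Properties using (_≟_)
open import Data.List using (List; length; filter)
open import Data.List using (allFin) public
open import Data.Product using (_×_; ∃)
open import Data.Sum using (_⊎_)
open import Relation.Binary.PropositionalEquality using (_≡_; _≢_)

-- The cycle C on vertex set Fin n (n ≥ 3): vertex a is adjacent to a+1 (mod n).
-- CycAdj n a b : there is an edge of C between a and b.
CycAdj : (n : ℕ) → Fin n → Fin n → Set
CycAdj n a b =
    (suc (toℕ a) ≡ toℕ b)
  ⊎ (suc (toℕ b) ≡ toℕ a)
  ⊎ ((toℕ a ≡ 0) × (suc (toℕ b) ≡ n))
  ⊎ ((toℕ b ≡ 0) × (suc (toℕ a) ≡ n))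

-- The partition S_0, S_1, …, S_k of V(C) is given by a labelling
-- lab : Fin n → Fin (suc k), with S_i = { v | lab v ≡ i }.
-- S_0 = lab⁻¹(zero) is the set of M-covered vertices.

sizeS₀ : {n k : ℕ} → (Fin n → Fin (suc k)) → ℕ
sizeS₀ {n} lab = length (filter (λ v → lab v ≟ Fin.zero) (allFin n))

-- M is a perfect matching on S_0, given by the partner map μ:
-- each v ∈ S_0 is matched to μ v ∈ S_0, μ v ≠ v, and μ (μ v) ≡ v.
-- (Values of μ outside S_0 are irrelevant.)  The edge set of M is
-- { {v, μ v} | v ∈ S_0 }.
IsPerfectMatchingOn : {n k : ℕ} → (Fin n → Fin (suc k)) → (Fin n → Fin n) → Set
IsPerfectMatchingOn {n} lab μ =
  (v : Fin n) → lab v ≡ Fin.zero →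
    (lab (μ v) ≡ Fin.zero) × (μ v ≢ v) × (μ (μ v) ≡ v)

MEdge : {n k : ℕ} → (Fin n → Fin (suc k)) → (Fin n → Fin n) → Fin n → Fin n → Set
MEdge lab μ a b = (lab a ≡ Fin.zero) × (μ a ≡ b)

-- An M-augmenting path in the connector C ∪ M with 2r+1 edges, given by its
-- vertex sequence p 0, p 1, …, p (2r+1):
--  * the vertices are pairwise distinct (it is a path);
--  * edges p(2t) p(2t+1) (t ≤ r) are edges of C, used as non-M edges
--    (a C-edge parallel to an M-edge is still a distinct, non-M edge);
--  * edges p(2t+1) p(2t+2) (t < r) are edges of M;
--  * both endpoints are M-exposed, i.e. lie in S_1 ∪ … ∪ S_k.
IsAugPath : (n k : ℕ) → (Fin n → Fin (suc k)) → (Fin n → Fin n) →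
            (r : ℕ) → (ℕ → Fin n) → Set
IsAugPath n k lab μ r p =
    ((i j : ℕ) → i ≤ 2 * r + 1 → j ≤ 2 * r + 1 → p i ≡ p j → i ≡ j)
  × ((t : ℕ) → t ≤ r → CycAdj n (p (2 * t)) (p (2 * t + 1)))
  × ((t : ℕ) → t < r → MEdge lab μ (p (2 * t + 1)) (p (2 * t + 2)))
  × (lab (p 0) ≢ Fin.zero)
  × (lab (p (2 * r + 1)) ≢ Fin.zero)

module Submission where

-- Fix a ∈ S_i and an exposed
-- b ∉ S_i.  We compare M with a matching N of cycle edges that pairs consecutive
-- positions along C and leaves unmatched only a centre c ∈ {a, b} and, when n is even,
-- one vertex z ∈ {b, successor of b}.  In N ∪ M every vertex has degree ≤ 2, so the
-- alternating walk (N, M, N, …) from a vertex of A = S_i ∩ (N-matched) is a path, and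
-- walks of odd length pair up their endpoints.  The centre is chosen so that |A| is odd;
-- then some walk from A ends at an exposed vertex outside S_i (an augmenting path) or,
-- after an M-edge, at z, from which a cycle edge leads to b.

open import Defs
open import Data.Nat using (ℕ; zero; suc; _+_; _*_; _∸_; _≤_; _<_; z≤n; s≤s; s≤s⁻¹)
open import Data.Nat.Properties
open import Relation.Binary using (tri<; tri≈; tri>)
open import Data.Bool using (Bool; true; false; not; if_then_else_)
open import Data.Bool.Properties using (not-involutive; not-injective; ¬-not) renaming (_≟_ to _≟ᵇ_)
open import Data.Fin using (Fin; toℕ; fromℕ<)
open import Data.Nat.DivMod using (_%_; %-distribˡ-+; m%n%n≡m%n; m%n<n; [m+n]%n≡m%n; m<n⇒m%n≡m; n%n≡0)
open import Data.Product using (_×_; _,_; ∃; proj₁; proj₂)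
open import Data.Sum using (_⊎_; inj₁; inj₂)
import Data.Sum
open import Data.Empty using (⊥; ⊥-elim)
open import Relation.Nullary using (¬_; Dec; yes; no)
open import Relation.Nullary.Decidable using (_×-dec_; _⊎-dec_; ¬?)
open import Relation.Unary using (Pred; Decidable)
open import Level using (0ℓ)
open import Data.Fin.Properties using (any?; pigeonhole; toℕ<n; toℕ-injective; toℕ-fromℕ<)
  renaming (_≟_ to _≟ᶠ_; suc-injective to fsuc-injective)
open import Relation.Binary.PropositionalEquality hiding (J)

even : ℕ → Bool
even zero = true
even (suc zero) = false
even (suc (suc n)) = even n

true≢false : true ≢ false
true≢false ()

even-suc : ∀ n → even (suc n) ≡ not (even n)
even-suc zero = refl
even-suc (suc zero) = refl
even-suc (suc (suc n)) = even-suc n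

even-+-even : ∀ {d} → even d ≡ true → ∀ i → even (i + d) ≡ even i
even-+-even d-even zero = d-even
even-+-even {d} d-even (suc zero) = trans (even-suc d) (cong not d-even)
even-+-even d-even (suc (suc i)) = even-+-even d-even i

even-+-odd : ∀ {d} → even d ≡ false → ∀ i → even (i + d) ≡ not (even i)
even-+-odd d-odd zero = d-odd
even-+-odd {d} d-odd (suc zero) = trans (even-suc d) (cong not d-odd)
even-+-odd d-odd (suc (suc i)) = even-+-odd d-odd i

even-sum⇒same-parity : ∀ i j → even (i + j) ≡ true → even i ≡ even j
even-sum⇒same-parity i j sum-even with even j in j-parity
... | true = trans (sym (even-+-even j-parity i)) sum-even
... | false = not-injective (trans (sym (even-+-odd j-parity i)) sum-even)

parity-pred : ∀ m {b} → even (suc m) ≡ b → even m ≡ not b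
parity-pred m parity = trans (sym (not-involutive (even m))) (cong not (trans (sym (even-suc m)) parity))

even-double : ∀ t → even (2 * t) ≡ true
even-double zero = refl
even-double (suc t) = trans (cong even (*-suc 2 t)) (even-double t)

even-double+1 : ∀ t → even (2 * t + 1) ≡ false
even-double+1 t = trans (cong even (+-comm (2 * t) 1)) (trans (even-suc (2 * t)) (cong not (even-double t)))

even-∸ : ∀ x y → even x ≡ even y → even (x ∸ y) ≡ true
even-∸ zero zero _ = refl
even-∸ zero (suc y) _ = refl
even-∸ (suc x) zero same = same
even-∸ (suc x) (suc y) same = even-∸ x y (not-injective (trans (sym (even-suc x)) (trans same (even-suc y))))

odd-form : ∀ j → even j ≡ false → ∃ λ r → j ≡ 2 * r + 1
odd-form (suc zero) _ = 0 , refl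
odd-form (suc (suc j)) j-odd with odd-form j j-odd
... | r , refl = suc r , cong (_+ 1) (sym (*-suc 2 r))

even-form : ∀ j → even j ≡ true → 0 < j → ∃ λ r → j ≡ 2 * r + 2
even-form (suc (suc zero)) _ _ = 0 , refl
even-form (suc (suc (suc j))) j-even _ with even-form (suc j) j-even (s≤s z≤n)
... | r , eq = suc r , trans (cong (λ x → suc (suc x)) eq) (cong (_+ 2) (sym (*-suc 2 r)))

count : ∀ {n} {P : Pred (Fin n) 0ℓ} → Decidable P → ℕ
count {zero} _ = 0
count {suc n} P? with P? Fin.zero
... | yes _ = suc (count (λ x → P? (Fin.suc x)))
... | no _ = count (λ x → P? (Fin.suc x))

count-cong : ∀ {n} {P Q : Pred (Fin n) 0ℓ} (P? : Decidable P) (Q? : Decidable Q) →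
             (∀ x → P x → Q x) → (∀ x → Q x → P x) → count P? ≡ count Q?
count-cong {zero} _ _ _ _ = refl
count-cong {suc n} P? Q? P⇒Q Q⇒P with P? Fin.zero | Q? Fin.zero
... | yes _ | yes _ = cong suc (count-cong _ _ (λ x → P⇒Q (Fin.suc x)) (λ x → Q⇒P (Fin.suc x)))
... | no _ | no _ = count-cong _ _ (λ x → P⇒Q (Fin.suc x)) (λ x → Q⇒P (Fin.suc x))
... | yes p | no ¬q = ⊥-elim (¬q (P⇒Q Fin.zero p))
... | no ¬p | yes q = ⊥-elim (¬p (Q⇒P Fin.zero q))

count-empty : ∀ {n} {P : Pred (Fin n) 0ℓ} (P? : Decidable P) → (∀ x → ¬ P x) → count P? ≡ 0
count-empty {zero} _ _ = refl
count-empty {suc n} P? none with P? Fin.zero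
... | yes p = ⊥-elim (none Fin.zero p)
... | no _ = count-empty _ (λ x → none (Fin.suc x))

_without_ : ∀ {n} {P : Pred (Fin n) 0ℓ} → Decidable P → (v : Fin n) → Decidable (λ x → P x × x ≢ v)
(P? without v) x = P? x ×-dec ¬? (x ≟ᶠ v)

without-suc : ∀ {n} {P : Pred (Fin (suc n)) 0ℓ} (P? : Decidable P) v →
              count ((λ x → P? (Fin.suc x)) without v) ≡ count (λ x → (P? without Fin.suc v) (Fin.suc x))
without-suc P? v = count-cong ((λ x → P? (Fin.suc x)) without v) (λ x → (P? without Fin.suc v) (Fin.suc x))
  (λ x (p , x≢v) → p , λ eq → x≢v (fsuc-injective eq))
  (λ x (p , sx≢sv) → p , λ eq → sx≢sv (cong Fin.suc eq))

count-remove : ∀ {n} {P : Pred (Fin n) 0ℓ} (P? : Decidable P) {v} → P v → count P? ≡ suc (count (P? without v))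
count-remove {suc n} P? {Fin.zero} p with P? Fin.zero
... | yes _ = cong suc (count-cong (λ x → P? (Fin.suc x)) (λ x → (P? without Fin.zero) (Fin.suc x))
                                   (λ x q → q , λ ()) (λ x → proj₁))
... | no ¬p = ⊥-elim (¬p p)
count-remove {suc n} P? {Fin.suc v} p with P? Fin.zero
... | yes _ = cong suc (trans (count-remove (λ x → P? (Fin.suc x)) p) (cong suc (without-suc P? v)))
... | no _ = trans (count-remove (λ x → P? (Fin.suc x)) p) (cong suc (without-suc P? v))

FPFInvolutionOn : ∀ {n} → Pred (Fin n) 0ℓ → (Fin n → Fin n) → Set
FPFInvolutionOn D f = ∀ v → D v → D (f v) × f v ≢ v × f (f v) ≡ v

-- A finite set carrying a fixed-point-free involution has even size: remove the
-- pair {v, f v} and recurse (on a fuel bound, since the subset changes).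
involution-even : ∀ {n} {D : Pred (Fin n) 0ℓ} (D? : Decidable D) {f} →
                  FPFInvolutionOn D f → even (count D?) ≡ true
involution-even {n} D? {f} inv = go (count D?) D? inv ≤-refl
  where
    go : ∀ fuel {D : Pred (Fin n) 0ℓ} (D? : Decidable D) → FPFInvolutionOn D f →
         count D? ≤ fuel → even (count D?) ≡ true
    go fuel D? inv bound with any? D?
    ... | no none = cong even (count-empty D? λ x p → none (x , p))
    ... | yes (v , v∈D) = subst (λ k → even k ≡ true) (sym count-D) (shrink fuel (subst (_≤ fuel) count-D bound))
      where
        fv∈D = proj₁ (inv v v∈D)
        fv≢v = proj₁ (proj₂ (inv v v∈D))
        ffv≡v = proj₂ (proj₂ (inv v v∈D))
        D₂? = (D? without v) without f v
        count-D : count D? ≡ suc (suc (count D₂?))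
        count-D = trans (count-remove D? v∈D) (cong suc (count-remove (D? without v) (fv∈D , fv≢v)))
        closed : FPFInvolutionOn _ f
        closed x ((x∈D , x≢v) , x≢fv) = ((fx∈D , fx≢v) , fx≢fv) , fx≢x , ffx≡x
          where
            fx∈D = proj₁ (inv x x∈D)
            fx≢x = proj₁ (proj₂ (inv x x∈D))
            ffx≡x = proj₂ (proj₂ (inv x x∈D))
            fx≢v : f x ≢ v
            fx≢v eq = x≢fv (trans (sym ffx≡x) (cong f eq))
            fx≢fv : f x ≢ f v
            fx≢fv eq = x≢v (trans (sym ffx≡x) (trans (cong f eq) ffv≡v))
        shrink : ∀ fuel → suc (suc (count D₂?)) ≤ fuel → even (count D₂?) ≡ true
        shrink (suc (suc fuel)) (s≤s (s≤s bound)) = go fuel D₂? closed bound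

firstFailure : {P : Pred ℕ 0ℓ} → Decidable P → ℕ → ℕ
firstFailure P? zero = zero
firstFailure P? (suc N) with P? 0
... | yes _ = suc (firstFailure (λ j → P? (suc j)) N)
... | no _ = zero

firstFailure-holds : {P : Pred ℕ 0ℓ} (P? : Decidable P) (N j : ℕ) → j < firstFailure P? N → P j
firstFailure-holds P? (suc N) j j<first with P? 0
firstFailure-holds P? (suc N) zero j<first | yes p0 = p0
firstFailure-holds P? (suc N) (suc j) j<first | yes _ = firstFailure-holds (λ j → P? (suc j)) N j (s≤s⁻¹ j<first)

firstFailure-fails : {P : Pred ℕ 0ℓ} (P? : Decidable P) (N : ℕ) → firstFailure P? N < N → ¬ P (firstFailure P? N)
firstFailure-fails P? (suc N) first<N with P? 0
... | yes _ = firstFailure-fails (λ j → P? (suc j)) N (s≤s⁻¹ first<N)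
... | no ¬p0 = ¬p0

firstFailure-unique : {P : Pred ℕ 0ℓ} (P? : Decidable P) (N t : ℕ) → t < N →
                      (∀ j → j < t → P j) → ¬ P t → firstFailure P? N ≡ t
firstFailure-unique P? N t t<N holds fails with <-cmp (firstFailure P? N) t
... | tri≈ _ eq _ = eq
... | tri< first<t _ _ = ⊥-elim (firstFailure-fails P? N (<-trans first<t t<N) (holds _ first<t))
... | tri> _ _ t<first = ⊥-elim (fails (firstFailure-holds P? N t t<first))

record Matching (n : ℕ) : Set₁ where
  field
    Covered : Pred (Fin n) 0ℓ
    covered? : Decidable Covered
    partner : Fin n → Fin n
    involutive : FPFInvolutionOn Covered partner

open Matching

module AlternatingWalk {n : ℕ} (α β : Matching n) where

  step : ℕ → Matching n
  step j = if even j then α else β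

  -- The walk from s; it is only meaningful while its steps are Live.
  walk : Fin n → ℕ → Fin n
  walk s zero = s
  walk s (suc j) = partner (step j) (walk s j)

  Live : Fin n → ℕ → Set
  Live s j = Covered (step j) (walk s j)

  live? : ∀ s → Decidable (Live s)
  live? s j = covered? (step j) (walk s j)

  len : Fin n → ℕ
  len s = firstFailure (live? s) (suc n)

  end : Fin n → Fin n
  end s = walk s (len s)

  step-parity : ∀ i j → even i ≡ even j → step i ≡ step j
  step-parity i j eq = cong (λ b → if b then α else β) eq

  step-mirror : ∀ t q → even (suc (t + q)) ≡ false → step t ≡ step q
  step-mirror t q odd = step-parity t q (even-sum⇒same-parity t q (parity-pred (t + q) odd))

  walk-next-covered : ∀ s j → Live s j → Covered (step j) (walk s (suc j))
  walk-next-covered s j live = proj₁ (involutive (step j) _ live)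

  walk-moves : ∀ s j → Live s j → walk s (suc j) ≢ walk s j
  walk-moves s j live = proj₁ (proj₂ (involutive (step j) _ live))

  walk-back : ∀ s j → Live s j → partner (step j) (walk s (suc j)) ≡ walk s j
  walk-back s j live = proj₂ (proj₂ (involutive (step j) _ live))

  module Injectivity (s : Fin n) (s∉β : ¬ Covered β s) (K : ℕ) (live : ∀ j → j < K → Live s j) where

    -- A repetition at even distance d can be pushed back to the start: s = walk s d.
    descend : ∀ i d → i + d ≤ K → even d ≡ true → walk s i ≡ walk s (i + d) → s ≡ walk s d
    descend zero d _ _ repeat = repeat
    descend (suc i) d bound d-even repeat = descend i d (<⇒≤ bound) d-even (begin
        walk s i                                       ≡⟨ sym (walk-back s i (live i i<K)) ⟩
        partner (step i) (walk s (suc i))              ≡⟨ cong₂ partner same-step repeat ⟩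
        partner (step (i + d)) (walk s (suc (i + d)))  ≡⟨ walk-back s (i + d) (live (i + d) bound) ⟩
        walk s (i + d)                                 ∎)
      where
        open ≡-Reasoning
        i<K = ≤-trans (s≤s (m≤m+n i d)) bound
        same-step = step-parity i (i + d) (sym (even-+-even d-even i))

    -- A repetition at odd distance o can be pushed inwards until a vertex equals its
    -- own partner, which is impossible.
    collapse : ∀ o i → even o ≡ false → i + o ≤ K → walk s i ≢ walk s (i + o)
    collapse (suc zero) i _ bound repeat =
      walk-moves s i (live i (subst (_≤ K) (+-comm i 1) bound)) (sym (trans repeat (cong (walk s) (+-comm i 1))))
    collapse (suc (suc o)) i o-odd bound repeat = collapse o (suc i) o-odd (<⇒≤ bound′) (begin
        walk s (suc i)                                     ≡⟨ cong (partner (step i)) repeat′ ⟩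
        partner (step i) (walk s (suc (suc (i + o))))
          ≡⟨ cong (λ M → partner M (walk s (suc (suc (i + o))))) same-step ⟩
        partner (step (suc (i + o))) (walk s (suc (suc (i + o)))) ≡⟨ walk-back s (suc (i + o)) (live _ bound′) ⟩
        walk s (suc (i + o))                               ∎)
      where
        open ≡-Reasoning
        shift : i + suc (suc o) ≡ suc (suc (i + o))
        shift = trans (+-suc i (suc o)) (cong suc (+-suc i o))
        bound′ : suc (suc (i + o)) ≤ K
        bound′ = subst (_≤ K) shift bound
        repeat′ : walk s i ≡ walk s (suc (suc (i + o)))
        repeat′ = trans repeat (cong (walk s) shift)
        same-step : step i ≡ step (suc (i + o))
        same-step = step-parity i (suc (i + o))
          (sym (trans (even-suc (i + o)) (trans (cong not (even-+-odd o-odd i)) (not-involutive (even i)))))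

    walk-injective : ∀ {i k} → i < k → k ≤ K → walk s i ≢ walk s k
    walk-injective {i} {k} i<k k≤K repeat with m≤n⇒∃[o]m+o≡n i<k
    ... | d , sd≡ = by-parity (even (suc d)) refl
      where
        k≡ : i + suc d ≡ k
        k≡ = trans (+-suc i d) sd≡
        repeat′ : walk s i ≡ walk s (i + suc d)
        repeat′ = trans repeat (cong (walk s) (sym k≡))
        bound : i + suc d ≤ K
        bound = subst (_≤ K) (sym k≡) k≤K
        -- at even distance, s would be the β-partner of walk s d
        by-parity : ∀ b → even (suc d) ≡ b → ⊥
        by-parity true sd-even = s∉β (subst (Covered β) (sym (descend i (suc d) bound sd-even repeat′))
          (subst (λ M → Covered M (walk s (suc d))) (step-parity d 1 (parity-pred d sd-even))
            (walk-next-covered s d (live d (≤-trans (m≤n+m (suc d) i) bound)))))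
        by-parity false sd-odd = collapse (suc d) i sd-odd bound repeat′

  len-live : ∀ s j → j < len s → Live s j
  len-live s = firstFailure-holds (live? s) (suc n)

  -- A walk from a β-exposed vertex stops within n steps, since it cannot repeat a vertex.
  len-bounded : ∀ s → ¬ Covered β s → len s < suc n
  len-bounded s s∉β with len s <? suc n
  ... | yes bounded = bounded
  ... | no unbounded with pigeonhole (n<1+n n) (λ t → walk s (toℕ t))
  ...   | a , b , a<b , repeat =
    ⊥-elim (Injectivity.walk-injective s s∉β (suc n) all-live a<b (<⇒≤ (toℕ<n b)) repeat)
    where
      all-live : ∀ j → j < suc n → Live s j
      all-live j j<sn = len-live s j (<-≤-trans j<sn (≮⇒≥ unbounded))

  len-dead : ∀ s → ¬ Covered β s → ¬ Live s (len s)
  len-dead s s∉β = firstFailure-fails (live? s) (suc n) (len-bounded s s∉β)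

  walk-injective-upto : ∀ s → ¬ Covered β s → ∀ i j → i ≤ len s → j ≤ len s → walk s i ≡ walk s j → i ≡ j
  walk-injective-upto s s∉β i j i≤ j≤ repeat with <-cmp i j
  ... | tri≈ _ i≡j _ = i≡j
  ... | tri< i<j _ _ = ⊥-elim (Injectivity.walk-injective s s∉β (len s) (len-live s) i<j j≤ repeat)
  ... | tri> _ _ j<i = ⊥-elim (Injectivity.walk-injective s s∉β (len s) (len-live s) j<i i≤ (sym repeat))

  len-positive : ∀ s → Covered α s → 0 < len s
  len-positive s s∈α with len s in len≡
  ... | suc _ = s≤s z≤n
  ... | zero = ⊥-elim (firstFailure-fails (live? s) (suc n) (subst (_< suc n) (sym len≡) (s≤s z≤n))
                                         (subst (Live s) (sym len≡) s∈α))

  -- A maximal walk of odd length from a β-exposed vertex s, read backwards, is the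
  -- maximal walk from its end; in particular the walk from end s ends at s.
  module Reversal (s : Fin n) (s∉β : ¬ Covered β s) (len-odd : even (len s) ≡ false) where

    reverse : ∀ t q → t + q ≡ len s → walk (end s) t ≡ walk s q
    reverse zero q q≡ = cong (walk s) (sym q≡)
    reverse (suc t) q t+q≡ = begin
        partner (step t) (walk (end s) t)  ≡⟨ cong₂ partner (step-mirror t q odd) (reverse t (suc q) t+sq≡) ⟩
        partner (step q) (walk s (suc q))  ≡⟨ walk-back s q (len-live s q q<len) ⟩
        walk s q                           ∎
      where
        open ≡-Reasoning
        t+sq≡ : t + suc q ≡ len s
        t+sq≡ = trans (+-suc t q) t+q≡
        odd : even (suc (t + q)) ≡ false
        odd = trans (cong even t+q≡) len-odd
        q<len : q < len s
        q<len = subst (q <_) t+q≡ (s≤s (m≤n+m q t))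

    reverse-live : ∀ t → t < len s → Live (end s) t
    reverse-live t t<len with m≤n⇒∃[o]m+o≡n t<len
    ... | q , sq≡ = subst₂ Covered (sym (step-mirror t q odd)) (sym (reverse t (suc q) t+sq≡))
                      (walk-next-covered s q (len-live s q (subst (q <_) t+sq≡ (m≤n+m (suc q) t))))
      where
        t+sq≡ : t + suc q ≡ len s
        t+sq≡ = trans (+-suc t q) sq≡
        odd : even (suc (t + q)) ≡ false
        odd = trans (cong even sq≡) len-odd

    reverse-dead : ¬ Live (end s) (len s)
    reverse-dead live = s∉β (subst₂ Covered β-step (reverse (len s) 0 (+-identityʳ (len s))) live)
      where
        β-step : step (len s) ≡ β
        β-step = step-parity (len s) 1 len-odd

    end-end : end (end s) ≡ s
    end-end = trans (cong (walk (end s)) len-end) (reverse (len s) 0 (+-identityʳ (len s)))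
      where
        len-end : len (end s) ≡ len s
        len-end = firstFailure-unique (live? (end s)) (suc n) (len s) (len-bounded s s∉β) reverse-live reverse-dead

  step-double : ∀ t → step (2 * t) ≡ α
  step-double t = step-parity (2 * t) 0 (even-double t)

  step-double+1 : ∀ t → step (2 * t + 1) ≡ β
  step-double+1 t = step-parity (2 * t + 1) 1 (even-double+1 t)

  walk-double+1 : ∀ s t → walk s (2 * t + 1) ≡ partner α (walk s (2 * t))
  walk-double+1 s t = trans (cong (walk s) (+-comm (2 * t) 1)) (cong (λ M → partner M (walk s (2 * t))) (step-double t))

  walk-double+2 : ∀ s t → walk s (2 * t + 2) ≡ partner β (walk s (2 * t + 1))
  walk-double+2 s t = trans (cong (walk s) (+-suc (2 * t) 1))
                            (cong (λ M → partner M (walk s (2 * t + 1))) (step-double+1 t))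

  live-double : ∀ s t → 2 * t < len s → Covered α (walk s (2 * t))
  live-double s t lt = subst (λ M → Covered M (walk s (2 * t))) (step-double t) (len-live s (2 * t) lt)

  live-double+1 : ∀ s t → 2 * t + 1 < len s → Covered β (walk s (2 * t + 1))
  live-double+1 s t lt = subst (λ M → Covered M (walk s (2 * t + 1))) (step-double+1 t) (len-live s (2 * t + 1) lt)

  -- Parity argument: if A consists of α-covered, β-exposed vertices and has odd size,
  -- then some walk from A has even length or ends outside A; otherwise the end map
  -- would be a fixed-point-free involution of A.
  unpaired : ∀ {A : Pred (Fin n) 0ℓ} (A? : Decidable A) → (∀ s → A s → Covered α s × ¬ Covered β s) →
             even (count A?) ≡ false → ∃ λ s → A s × (even (len s) ≡ true ⊎ ¬ A (end s))
  unpaired {A} A? A-ends A-odd with any? (λ s → A? s ×-dec ((even (len s) ≟ᵇ true) ⊎-dec ¬? (A? (end s))))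
  ... | yes found = found
  ... | no none = ⊥-elim (true≢false (trans (sym (involution-even A? paired)) A-odd))
    where
      paired : FPFInvolutionOn A end
      paired s s∈A = end∈A , end≢s , Reversal.end-end s s∉β len-odd
        where
          s∈α = proj₁ (A-ends s s∈A)
          s∉β = proj₂ (A-ends s s∈A)
          len-odd : even (len s) ≡ false
          len-odd = ¬-not (λ len-even → none (s , s∈A , inj₁ len-even))
          end∈A : A (end s)
          end∈A with A? (end s)
          ... | yes a = a
          ... | no ¬a = ⊥-elim (none (s , s∈A , inj₂ ¬a))
          end≢s : end s ≢ s
          end≢s eq = <-irrefl (walk-injective-upto s s∉β 0 (len s) z≤n ≤-refl (sym eq)) (len-positive s s∈α)

swap : ℕ → ℕ
swap zero = 1
swap (suc zero) = 0
swap (suc (suc y)) = suc (suc (swap y))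

swap-involutive : ∀ y → swap (swap y) ≡ y
swap-involutive zero = refl
swap-involutive (suc zero) = refl
swap-involutive (suc (suc y)) = cong (λ z → suc (suc z)) (swap-involutive y)

swap-adjacent : ∀ y → swap y ≡ suc y ⊎ suc (swap y) ≡ y
swap-adjacent zero = inj₁ refl
swap-adjacent (suc zero) = inj₂ refl
swap-adjacent (suc (suc y)) = Data.Sum.map (cong (λ z → suc (suc z))) (cong (λ z → suc (suc z))) (swap-adjacent y)

swap-bound : ∀ B → even B ≡ true → ∀ y → y < B → swap y < B
swap-bound (suc (suc B)) _ zero _ = s≤s (s≤s z≤n)
swap-bound (suc (suc B)) _ (suc zero) _ = s≤s z≤n
swap-bound (suc (suc B)) B-even (suc (suc y)) (s≤s (s≤s y<B)) = s≤s (s≤s (swap-bound B B-even y y<B))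

offset-bound : ∀ n k y → y < n ∸ k → k + y < n
offset-bound (suc n) zero y y<n = y<n
offset-bound (suc n) (suc k) y y<n∸k = s≤s (offset-bound n k y y<n∸k)

-- Positions 0, 1, …, n - 1 of a cycle with two marked positions 0 and suc a, where
-- both arcs between them have an even number of positions (or a single marked
-- position, when suc a = n): the positions of each arc are matched in consecutive pairs.
module ArcPairing (n a : ℕ) (a-even : even a ≡ true) (L≤n : suc a ≤ n)
                  (rest-even : even (n ∸ suc (suc a)) ≡ true) where

  Matched : ℕ → Set
  Matched x = 0 < x × x ≢ suc a × x < n

  matched? : ∀ x → Dec (Matched x)
  matched? x = (0 <? x) ×-dec (¬? (x ≟ suc a) ×-dec (x <? n))

  unmatched : ∀ x → x < n → ¬ Matched x → x ≡ 0 ⊎ x ≡ suc a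
  unmatched zero _ _ = inj₁ refl
  unmatched (suc x) x<n ¬matched with suc x ≟ suc a
  ... | yes x≡L = inj₂ x≡L
  ... | no x≢L = ⊥-elim (¬matched (s≤s z≤n , x≢L , x<n))

  partnerPos : ℕ → ℕ
  partnerPos x with x ≤? a
  ... | yes _ = suc (swap (x ∸ 1))
  ... | no _ = suc (suc a) + swap (x ∸ suc (suc a))

  data Arc : ℕ → Set where
    before : ∀ y → y < a → Arc (suc y)
    after : ∀ y → y < n ∸ suc (suc a) → Arc (suc (suc a) + y)

  arc : ∀ x → Matched x → Arc x
  arc (suc y) (_ , x≢L , x<n) with suc y ≤? a
  ... | yes y<a = before y y<a
  ... | no y≮a = subst Arc (m+[n∸m]≡n L<x) (after (suc y ∸ suc (suc a)) (∸-monoˡ-< x<n L<x))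
    where
      L<x : suc a < suc y
      L<x = ≤∧≢⇒< (≰⇒> y≮a) (λ eq → x≢L (sym eq))

  arc-matched : ∀ {x} → Arc x → Matched x
  arc-matched (before y y<a) = s≤s z≤n , (λ eq → <-irrefl (suc-injective eq) y<a) , <-≤-trans (s≤s y<a) L≤n
  arc-matched (after y y<rest) = s≤s z≤n , (λ eq → <-irrefl (sym eq) (s≤s (m≤m+n (suc a) y))) ,
                                 offset-bound n (suc (suc a)) y y<rest

  partnerPos-before : ∀ y → y < a → partnerPos (suc y) ≡ suc (swap y)
  partnerPos-before y y<a with suc y ≤? a
  ... | yes _ = refl
  ... | no y≮a = ⊥-elim (y≮a y<a)

  partnerPos-after : ∀ y → partnerPos (suc (suc a) + y) ≡ suc (suc a) + swap y
  partnerPos-after y with suc (suc a) + y ≤? a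
  ... | yes after≤a = ⊥-elim (<-irrefl refl (≤-trans (s≤s (m≤m+n (suc a) y)) (≤-trans after≤a (n≤1+n a))))
  ... | no _ = cong (λ z → suc (suc a) + swap z) (m+n∸m≡n (suc (suc a)) y)

  partner-arc : ∀ {x} → Arc x → Arc (partnerPos x) × partnerPos (partnerPos x) ≡ x
  partner-arc (before y y<a) rewrite partnerPos-before y y<a =
    before (swap y) sy<a , trans (partnerPos-before (swap y) sy<a) (cong suc (swap-involutive y))
    where sy<a = swap-bound a a-even y y<a
  partner-arc (after y y<rest) rewrite partnerPos-after y =
    after (swap y) (swap-bound _ rest-even y y<rest) ,
    trans (partnerPos-after (swap y)) (cong (suc (suc a) +_) (swap-involutive y))

  partner-neighbour : ∀ {x} → Arc x → partnerPos x ≡ suc x ⊎ suc (partnerPos x) ≡ x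
  partner-neighbour (before y y<a) rewrite partnerPos-before y y<a =
    Data.Sum.map (cong suc) (cong suc) (swap-adjacent y)
  partner-neighbour (after y _) rewrite partnerPos-after y =
    Data.Sum.map (λ eq → trans (cong (suc (suc a) +_) eq) (+-suc (suc (suc a)) y))
                 (λ eq → trans (sym (+-suc (suc (suc a)) (swap y))) (cong (suc (suc a) +_) eq))
                 (swap-adjacent y)

-- The cycle C on Fin n, n = suc m, described by positions relative to a vertex c:
-- vertexAt c x is the vertex x steps after c, and pos c v the position of v.
module Positions (m : ℕ) where

  n : ℕ
  n = suc m

  %-absorbˡ : ∀ x y → (x % n + y) % n ≡ (x + y) % n
  %-absorbˡ x y = begin
      (x % n + y) % n          ≡⟨ %-distribˡ-+ (x % n) y n ⟩
      (x % n % n + y % n) % n  ≡⟨ cong (λ t → (t + y % n) % n) (m%n%n≡m%n x n) ⟩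
      (x % n + y % n) % n      ≡⟨ sym (%-distribˡ-+ x y n) ⟩
      (x + y) % n              ∎
    where open ≡-Reasoning

  vertexAt : Fin n → ℕ → Fin n
  vertexAt c x = fromℕ< (m%n<n (x + toℕ c) n)

  pos : Fin n → Fin n → ℕ
  pos c v = (toℕ v + (n ∸ toℕ c)) % n

  toℕ-vertexAt : ∀ c x → toℕ (vertexAt c x) ≡ (x + toℕ c) % n
  toℕ-vertexAt c x = toℕ-fromℕ< (m%n<n (x + toℕ c) n)

  pos<n : ∀ c v → pos c v < n
  pos<n c v = m%n<n (toℕ v + (n ∸ toℕ c)) n

  full-turn : ∀ c x → x + toℕ c + (n ∸ toℕ c) ≡ x + n
  full-turn c x = trans (+-assoc x (toℕ c) _) (cong (x +_) (m+[n∸m]≡n (<⇒≤ (toℕ<n c))))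

  full-turn′ : ∀ c x → x + (n ∸ toℕ c) + toℕ c ≡ x + n
  full-turn′ c x = trans (+-assoc x _ (toℕ c)) (cong (x +_) (m∸n+n≡m (<⇒≤ (toℕ<n c))))

  vertexAt-pos : ∀ c v → vertexAt c (pos c v) ≡ v
  vertexAt-pos c v = toℕ-injective (begin
      toℕ (vertexAt c (pos c v))                 ≡⟨ toℕ-vertexAt c (pos c v) ⟩
      (pos c v + toℕ c) % n                      ≡⟨ %-absorbˡ (toℕ v + (n ∸ toℕ c)) (toℕ c) ⟩
      (toℕ v + (n ∸ toℕ c) + toℕ c) % n          ≡⟨ cong (_% n) (full-turn′ c (toℕ v)) ⟩
      (toℕ v + n) % n                            ≡⟨ [m+n]%n≡m%n (toℕ v) n ⟩
      toℕ v % n                                  ≡⟨ m<n⇒m%n≡m (toℕ<n v) ⟩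
      toℕ v                                      ∎)
    where open ≡-Reasoning

  pos-vertexAt : ∀ c x → x < n → pos c (vertexAt c x) ≡ x
  pos-vertexAt c x x<n = begin
      (toℕ (vertexAt c x) + (n ∸ toℕ c)) % n     ≡⟨ cong (λ t → (t + (n ∸ toℕ c)) % n) (toℕ-vertexAt c x) ⟩
      ((x + toℕ c) % n + (n ∸ toℕ c)) % n        ≡⟨ %-absorbˡ (x + toℕ c) (n ∸ toℕ c) ⟩
      (x + toℕ c + (n ∸ toℕ c)) % n              ≡⟨ cong (_% n) (full-turn c x) ⟩
      (x + n) % n                                ≡⟨ [m+n]%n≡m%n x n ⟩
      x % n                                      ≡⟨ m<n⇒m%n≡m x<n ⟩
      x                                          ∎
    where open ≡-Reasoning

  pos-injective : ∀ c {u v} → pos c u ≡ pos c v → u ≡ v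
  pos-injective c {u} {v} eq = trans (sym (vertexAt-pos c u)) (trans (cong (vertexAt c) eq) (vertexAt-pos c v))

  vertexAt-zero : ∀ c → vertexAt c 0 ≡ c
  vertexAt-zero c = toℕ-injective (trans (toℕ-vertexAt c 0) (m<n⇒m%n≡m (toℕ<n c)))

  at-position : ∀ c {v x} → pos c v ≡ x → v ≡ vertexAt c x
  at-position c {v} eq = trans (sym (vertexAt-pos c v)) (cong (vertexAt c) eq)

  pos-zero : ∀ c {v} → pos c v ≡ 0 → v ≡ c
  pos-zero c eq = trans (at-position c eq) (vertexAt-zero c)

  pos-self : ∀ c → pos c c ≡ 0
  pos-self c = trans (cong (pos c) (sym (vertexAt-zero c))) (pos-vertexAt c 0 (s≤s z≤n))

  adjacent-sym : ∀ {u v} → CycAdj n u v → CycAdj n v u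
  adjacent-sym (inj₁ e) = inj₂ (inj₁ e)
  adjacent-sym (inj₂ (inj₁ e)) = inj₁ e
  adjacent-sym (inj₂ (inj₂ (inj₁ e))) = inj₂ (inj₂ (inj₂ e))
  adjacent-sym (inj₂ (inj₂ (inj₂ e))) = inj₂ (inj₂ (inj₁ e))

  successor-adjacent : ∀ u v → toℕ v ≡ suc (toℕ u) % n → CycAdj n u v
  successor-adjacent u v v≡ with suc (toℕ u) <? n
  ... | yes below = inj₁ (sym (trans v≡ (m<n⇒m%n≡m below)))
  ... | no wraps = inj₂ (inj₂ (inj₂ (trans v≡ (trans (cong (_% n) last) (n%n≡0 n)) , last)))
    where
      last : suc (toℕ u) ≡ n
      last = ≤-antisym (toℕ<n u) (≮⇒≥ wraps)

  consecutive-adjacent : ∀ c x → CycAdj n (vertexAt c x) (vertexAt c (suc x))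
  consecutive-adjacent c x = successor-adjacent _ _ (begin
      toℕ (vertexAt c (suc x))            ≡⟨ toℕ-vertexAt c (suc x) ⟩
      suc (x + toℕ c) % n                 ≡⟨ cong (_% n) (+-comm 1 (x + toℕ c)) ⟩
      (x + toℕ c + 1) % n                 ≡⟨ sym (%-absorbˡ (x + toℕ c) 1) ⟩
      ((x + toℕ c) % n + 1) % n           ≡⟨ cong (λ t → (t + 1) % n) (sym (toℕ-vertexAt c x)) ⟩
      (toℕ (vertexAt c x) + 1) % n        ≡⟨ cong (_% n) (+-comm (toℕ (vertexAt c x)) 1) ⟩
      suc (toℕ (vertexAt c x)) % n        ∎)
    where open ≡-Reasoning

append : ∀ {n} → (ℕ → Fin n) → ℕ → Fin n → ℕ → Fin n
append w J b t with t ≤? J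
... | yes _ = w t
... | no _ = b

append-≤ : ∀ {n} (w : ℕ → Fin n) J b {t} → t ≤ J → append w J b t ≡ w t
append-≤ w J b {t} t≤J with t ≤? J
... | yes _ = refl
... | no t≰J = ⊥-elim (t≰J t≤J)

append-last : ∀ {n} (w : ℕ → Fin n) J b → append w J b (suc J) ≡ b
append-last w J b with suc J ≤? J
... | yes J<J = ⊥-elim (<-irrefl refl J<J)
... | no _ = refl

append-injective : ∀ {n} (w : ℕ → Fin n) J b →
                   (∀ u v → u ≤ J → v ≤ J → w u ≡ w v → u ≡ v) → (∀ v → v ≤ J → w v ≢ b) →
                   ∀ u v → u ≤ suc J → v ≤ suc J → append w J b u ≡ append w J b v → u ≡ v
append-injective w J b w-injective b-new u v u≤ v≤ eq with u ≤? J | v ≤? J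
... | yes u≤J | yes v≤J = w-injective u v u≤J v≤J eq
... | yes u≤J | no _ = ⊥-elim (b-new u u≤J eq)
... | no _ | yes v≤J = ⊥-elim (b-new v v≤J (sym eq))
... | no u≰J | no v≰J = trans (≤-antisym u≤ (≰⇒> u≰J)) (sym (≤-antisym v≤ (≰⇒> v≰J)))

module Construction (m k : ℕ) (lab : Fin (suc m) → Fin (suc k)) (μ : Fin (suc m) → Fin (suc m))
                    (μ-perfect : IsPerfectMatchingOn lab μ) (i : Fin (suc k)) (i≢0 : i ≢ Fin.zero) where

  open Positions m

  AugmentingFromSᵢ : Set
  AugmentingFromSᵢ = ∃ λ r → ∃ λ (p : ℕ → Fin n) →
    IsAugPath n k lab μ r p × (lab (p 0) ≡ i) × (lab (p (2 * r + 1)) ≢ i)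

  M : Matching n
  M = record { Covered = λ v → lab v ≡ Fin.zero ; covered? = λ v → lab v ≟ᶠ Fin.zero
             ; partner = μ ; involutive = μ-perfect }

  Sᵢ? : Decidable (λ v → lab v ≡ i)
  Sᵢ? v = lab v ≟ᶠ i

  HasExit : Fin n → Set
  HasExit y = ∃ λ b → lab b ≢ Fin.zero × lab b ≢ i × CycAdj n y b

  GoodCentre : Fin n → Set
  GoodCentre c = lab c ≢ Fin.zero × even (count (Sᵢ? without c)) ≡ false

  single-edge : ∀ x y → CycAdj n x y → lab x ≡ i → lab y ≢ Fin.zero → lab y ≢ i → AugmentingFromSᵢ
  single-edge x y xy x∈Sᵢ y-exposed y∉Sᵢ =
    0 , p , (distinct , (λ { zero _ → xy }) , (λ _ ()) , (λ x∈S₀ → i≢0 (trans (sym x∈Sᵢ) x∈S₀)) , y-exposed) ,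
    x∈Sᵢ , y∉Sᵢ
    where
      p : ℕ → Fin n
      p zero = x
      p (suc _) = y
      distinct : ∀ u v → u ≤ 1 → v ≤ 1 → p u ≡ p v → u ≡ v
      distinct zero zero _ _ _ = refl
      distinct zero (suc zero) _ _ x≡y = ⊥-elim (y∉Sᵢ (trans (cong lab (sym x≡y)) x∈Sᵢ))
      distinct (suc zero) zero _ _ y≡x = ⊥-elim (y∉Sᵢ (trans (cong lab y≡x) x∈Sᵢ))
      distinct (suc zero) (suc zero) _ _ _ = refl
      distinct _ (suc (suc _)) _ (s≤s ())
      distinct (suc (suc _)) _ (s≤s ()) _

  -- Walks alternating between M and a reference matching N of cycle edges, which
  -- leaves exactly the exposed centre c and the vertex at position suc a unmatched.
  module Reference (c : Fin n) (c-exposed : lab c ≢ Fin.zero) (a : ℕ) (a-even : even a ≡ true)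
                   (L≤n : suc a ≤ n) (rest-even : even (n ∸ suc (suc a)) ≡ true) where

    open ArcPairing n a a-even L≤n rest-even

    ν : Fin n → Fin n
    ν v = vertexAt c (partnerPos (pos c v))

    pos-ν : ∀ v → Matched (pos c v) → pos c (ν v) ≡ partnerPos (pos c v)
    pos-ν v matched = pos-vertexAt c _ (proj₂ (proj₂ (arc-matched (proj₁ (partner-arc (arc _ matched))))))

    ν-involutive : FPFInvolutionOn (λ v → Matched (pos c v)) ν
    ν-involutive v matched = subst Matched (sym (pos-ν v matched)) (arc-matched (proj₁ (partner-arc x-arc))) ,
                             moves , back
      where
        open ≡-Reasoning
        x-arc = arc (pos c v) matched
        moves : ν v ≢ v
        moves ν≡v with partner-neighbour x-arc | trans (sym (pos-ν v matched)) (cong (pos c) ν≡v)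
        ... | inj₁ up | fixed = 1+n≢n (trans (sym up) fixed)
        ... | inj₂ down | fixed = 1+n≢n (trans (cong suc (sym fixed)) down)
        back : ν (ν v) ≡ v
        back = begin
          vertexAt c (partnerPos (pos c (ν v)))        ≡⟨ cong (λ x → vertexAt c (partnerPos x)) (pos-ν v matched) ⟩
          vertexAt c (partnerPos (partnerPos (pos c v))) ≡⟨ cong (vertexAt c) (proj₂ (partner-arc x-arc)) ⟩
          vertexAt c (pos c v)                         ≡⟨ vertexAt-pos c v ⟩
          v                                            ∎

    ν-adjacent : ∀ v → Matched (pos c v) → CycAdj n v (ν v)
    ν-adjacent v matched with partner-neighbour (arc (pos c v) matched)
    ... | inj₁ up = subst₂ (CycAdj n) (vertexAt-pos c v) (cong (vertexAt c) (sym up))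
                      (consecutive-adjacent c (pos c v))
    ... | inj₂ down = subst (λ u → CycAdj n u (ν v)) (trans (cong (vertexAt c) down) (vertexAt-pos c v))
                        (adjacent-sym (consecutive-adjacent c (partnerPos (pos c v))))

    N : Matching n
    N = record { Covered = λ v → Matched (pos c v) ; covered? = λ v → matched? (pos c v)
               ; partner = ν ; involutive = ν-involutive }

    open AlternatingWalk N M

    A : Pred (Fin n) 0ℓ
    A v = lab v ≡ i × Matched (pos c v)

    A? : Decidable A
    A? v = (lab v ≟ᶠ i) ×-dec matched? (pos c v)

    A-count : (∀ v → pos c v ≡ suc a → lab v ≢ i) → count A? ≡ count (Sᵢ? without c)
    A-count L∉Sᵢ = count-cong A? (Sᵢ? without c)
      (λ v (v∈Sᵢ , (0<pos , _)) → v∈Sᵢ , λ v≡c → <-irrefl (sym (trans (cong (pos c) v≡c) (pos-self c))) 0<pos)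
      (λ v (v∈Sᵢ , v≢c) → v∈Sᵢ , nonzero v v≢c , (λ at-L → L∉Sᵢ v at-L v∈Sᵢ) , pos<n c v)
      where
        nonzero : ∀ v → v ≢ c → 0 < pos c v
        nonzero v v≢c with pos c v in pos≡
        ... | zero = ⊥-elim (v≢c (pos-zero c pos≡))
        ... | suc _ = s≤s z≤n

    A-exposed : ∀ s → A s → ¬ Covered M s
    A-exposed s (s∈Sᵢ , _) s∈S₀ = i≢0 (trans (sym s∈Sᵢ) s∈S₀)

    cycle-edge : ∀ s t → 2 * t < len s → CycAdj n (walk s (2 * t)) (walk s (2 * t + 1))
    cycle-edge s t lt = subst (CycAdj n _) (sym (walk-double+1 s t)) (ν-adjacent _ (live-double s t lt))

    matching-edge : ∀ s t → 2 * t + 1 < len s → MEdge lab μ (walk s (2 * t + 1)) (walk s (2 * t + 2))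
    matching-edge s t lt = live-double+1 s t lt , sym (walk-double+2 s t)

    -- A walk of odd length 2r + 1 from A ending outside A is itself an augmenting
    -- path: its end is N-matched (hence not in S_i) and M-exposed (the walk stopped).
    odd-walk-path : ∀ s → A s → ¬ A (end s) → ∀ r → len s ≡ 2 * r + 1 → AugmentingFromSᵢ
    odd-walk-path s s∈A end∉A r len≡ =
      r , walk s , (distinct , edges , M-edges , A-exposed s s∈A , end-exposed) , proj₁ s∈A , end∉Sᵢ
      where
        s∉S₀ = A-exposed s s∈A
        to-len : ∀ {j} → j ≤ 2 * r + 1 → j ≤ len s
        to-len = subst (_ ≤_) (sym len≡)
        distinct : ∀ u v → u ≤ 2 * r + 1 → v ≤ 2 * r + 1 → walk s u ≡ walk s v → u ≡ v
        distinct u v u≤ v≤ = walk-injective-upto s s∉S₀ u v (to-len u≤) (to-len v≤)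
        edges : ∀ t → t ≤ r → CycAdj n (walk s (2 * t)) (walk s (2 * t + 1))
        edges t t≤r = cycle-edge s t (to-len (subst (2 * t <_) (+-comm 1 (2 * r)) (s≤s (*-monoʳ-≤ 2 t≤r))))
        M-edges : ∀ t → t < r → MEdge lab μ (walk s (2 * t + 1)) (walk s (2 * t + 2))
        M-edges t t<r = matching-edge s t (to-len (+-monoˡ-< 1 (*-monoʳ-< 2 t<r)))
        end-exposed : lab (walk s (2 * r + 1)) ≢ Fin.zero
        end-exposed end∈S₀ = len-dead s s∉S₀
          (subst (Live s) (sym len≡)
            (subst (λ M′ → Covered M′ (walk s (2 * r + 1))) (sym (step-double+1 r)) end∈S₀))
        end-matched : Matched (pos c (walk s (2 * r + 1)))
        end-matched = subst (λ v → Matched (pos c v)) (sym (walk-double+1 s r))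
          (proj₁ (ν-involutive (walk s (2 * r))
            (live-double s r (subst (2 * r <_) (sym len≡) (m<m+n (2 * r) (s≤s z≤n))))))
        end∉Sᵢ : lab (walk s (2 * r + 1)) ≢ i
        end∉Sᵢ end∈Sᵢ = end∉A (subst (λ j → A (walk s j)) (sym len≡) (end∈Sᵢ , end-matched))

    -- A walk of even length 2r + 2 from A ends in S_0 at a vertex not matched by N,
    -- i.e. at position suc a; appending a cycle edge to an exposed vertex b of
    -- another class gives an augmenting path.
    module EvenWalk (s : Fin n) (s∈A : A s) (r : ℕ) (len≡ : len s ≡ 2 * r + 2) where

      J : ℕ
      J = 2 * r + 2

      s∉S₀ = A-exposed s s∈A

      J-even : even J ≡ true
      J-even = trans (even-+-even {2} refl (2 * r)) (even-double r)

      -- After the start, the walk stays in S_0: odd-indexed vertices are M-covered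
      -- because the walk continues, even-indexed ones are M-partners.
      inner∈S₀ : ∀ t → t < J → lab (walk s (suc t)) ≡ Fin.zero
      inner∈S₀ t t<J = by-parity (even t) refl
        where
          by-parity : ∀ b → even t ≡ b → lab (walk s (suc t)) ≡ Fin.zero
          by-parity false t-odd = subst (λ M′ → Covered M′ (walk s (suc t))) (step-parity t 1 t-odd)
                                    (walk-next-covered s t (len-live s t (subst (t <_) (sym len≡) t<J)))
          by-parity true t-even = subst (λ M′ → Covered M′ (walk s (suc t))) (step-parity (suc t) 1 st-odd)
                                    (len-live s (suc t) (subst (suc t <_) (sym len≡) (≤∧≢⇒< t<J st≢J)))
            where
              st-odd : even (suc t) ≡ false
              st-odd = trans (even-suc t) (cong not t-even)
              st≢J : suc t ≢ J
              st≢J st≡J = true≢false (trans (sym J-even) (trans (cong even (sym st≡J)) st-odd))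

      walk-labels : ∀ t → t ≤ J → lab (walk s t) ≡ i ⊎ lab (walk s t) ≡ Fin.zero
      walk-labels zero _ = inj₁ (proj₁ s∈A)
      walk-labels (suc t) st≤J = inj₂ (inner∈S₀ t st≤J)

      last∈S₀ : lab (walk s J) ≡ Fin.zero
      last∈S₀ = subst (λ j → lab (walk s j) ≡ Fin.zero) (sym (+-suc (2 * r) 1))
                  (inner∈S₀ (2 * r + 1) (subst (2 * r + 1 <_) (sym (+-suc (2 * r) 1)) (n<1+n _)))

      -- The walk stopped at its last vertex, which is therefore not matched by N; being
      -- in S_0 it is not c, so it sits at the second marked position.
      last-unmatched : ¬ Matched (pos c (walk s J))
      last-unmatched matched = len-dead s s∉S₀ (subst (Live s) (sym len≡)
        (subst (λ M′ → Covered M′ (walk s J)) (sym (step-parity J 0 J-even)) matched))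

      last-position : pos c (walk s J) ≡ suc a
      last-position with unmatched (pos c (walk s J)) (pos<n c (walk s J)) last-unmatched
      ... | inj₁ at-c = ⊥-elim (c-exposed (subst (λ v → lab v ≡ Fin.zero) (pos-zero c at-c) last∈S₀))
      ... | inj₂ at-L = at-L

      extended-path : ∀ b → lab b ≢ Fin.zero → lab b ≢ i → CycAdj n (walk s J) b → AugmentingFromSᵢ
      extended-path b b-exposed b∉Sᵢ last-b =
        suc r , p , (distinct , edges , M-edges , s-exposed , b-exposed′) , s∈Sᵢ , b∉Sᵢ′
        where
          p : ℕ → Fin n
          p = append (walk s) J b
          double≡J : 2 * suc r ≡ J
          double≡J = trans (*-suc 2 r) (+-comm 2 (2 * r))
          last≡ : 2 * suc r + 1 ≡ suc J
          last≡ = trans (cong (_+ 1) double≡J) (+-comm J 1)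
          p-walk : ∀ {t} → t ≤ J → p t ≡ walk s t
          p-walk = append-≤ (walk s) J b
          p-last : p (2 * suc r + 1) ≡ b
          p-last = trans (cong p last≡) (append-last (walk s) J b)
          distinct : ∀ u v → u ≤ 2 * suc r + 1 → v ≤ 2 * suc r + 1 → p u ≡ p v → u ≡ v
          distinct u v u≤ v≤ = append-injective (walk s) J b walk-injective b-new u v
                                 (subst (u ≤_) last≡ u≤) (subst (v ≤_) last≡ v≤)
            where
              walk-injective : ∀ u v → u ≤ J → v ≤ J → walk s u ≡ walk s v → u ≡ v
              walk-injective u v u≤J v≤J = walk-injective-upto s s∉S₀ u v
                (subst (u ≤_) (sym len≡) u≤J) (subst (v ≤_) (sym len≡) v≤J)
              b-new : ∀ v → v ≤ J → walk s v ≢ b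
              b-new v v≤J w≡b with walk-labels v v≤J
              ... | inj₁ in-Sᵢ = b∉Sᵢ (trans (cong lab (sym w≡b)) in-Sᵢ)
              ... | inj₂ in-S₀ = b-exposed (trans (cong lab (sym w≡b)) in-S₀)
          edges : ∀ t → t ≤ suc r → CycAdj n (p (2 * t)) (p (2 * t + 1))
          edges t t≤sr with m≤n⇒m<n∨m≡n t≤sr
          ... | inj₂ refl = subst₂ (CycAdj n) (sym (trans (cong p double≡J) (p-walk ≤-refl))) (sym p-last) last-b
          ... | inj₁ t<sr = subst₂ (CycAdj n) (sym (p-walk (<⇒≤ 2t<J))) (sym (p-walk 2t+1<J))
                              (cycle-edge s t (subst (2 * t <_) (sym len≡) 2t<J))
            where
              2t≤2r = *-monoʳ-≤ 2 (s≤s⁻¹ t<sr)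
              2t<J : 2 * t < J
              2t<J = ≤-<-trans 2t≤2r (m<m+n (2 * r) (s≤s z≤n))
              2t+1<J : 2 * t + 1 ≤ J
              2t+1<J = ≤-trans (+-monoˡ-≤ 1 2t≤2r) (+-monoʳ-≤ (2 * r) (s≤s z≤n))
          M-edges : ∀ t → t < suc r → MEdge lab μ (p (2 * t + 1)) (p (2 * t + 2))
          M-edges t t<sr = subst₂ (MEdge lab μ) (sym (p-walk (<⇒≤ 2t+1<J))) (sym (p-walk 2t+2≤J))
                             (matching-edge s t (subst (2 * t + 1 <_) (sym len≡) 2t+1<J))
            where
              2t+2≤J : 2 * t + 2 ≤ J
              2t+2≤J = +-monoˡ-≤ 2 (*-monoʳ-≤ 2 (s≤s⁻¹ t<sr))
              2t+1<J : 2 * t + 1 < J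
              2t+1<J = subst (_≤ J) (+-suc (2 * t) 1) 2t+2≤J
          s∈Sᵢ : lab (p 0) ≡ i
          s∈Sᵢ = trans (cong lab (p-walk z≤n)) (proj₁ s∈A)
          s-exposed : lab (p 0) ≢ Fin.zero
          s-exposed p0∈S₀ = s∉S₀ (trans (cong lab (sym (p-walk z≤n))) p0∈S₀)
          b-exposed′ : lab (p (2 * suc r + 1)) ≢ Fin.zero
          b-exposed′ = subst (λ v → lab v ≢ Fin.zero) (sym p-last) b-exposed
          b∉Sᵢ′ : lab (p (2 * suc r + 1)) ≢ i
          b∉Sᵢ′ = subst (λ v → lab v ≢ i) (sym p-last) b∉Sᵢ

    augmenting-path : even (count A?) ≡ false →
      (∀ y → pos c y ≡ suc a → lab y ≡ Fin.zero → HasExit y) →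
      AugmentingFromSᵢ
    augmenting-path A-odd escape with unpaired A? (λ s s∈A → proj₂ s∈A , A-exposed s s∈A) A-odd
    ... | s , s∈A , ending = by-parity (even (len s)) refl ending
      where
        by-parity : ∀ e → even (len s) ≡ e → even (len s) ≡ true ⊎ ¬ A (end s) → AugmentingFromSᵢ
        by-parity false len-odd (inj₁ len-even) = ⊥-elim (true≢false (trans (sym len-even) len-odd))
        by-parity false len-odd (inj₂ end∉A) =
          let (r , len≡) = odd-form (len s) len-odd in odd-walk-path s s∈A end∉A r len≡
        by-parity true len-even _ =
          let (r , len≡) = even-form (len s) len-even (len-positive s (proj₂ s∈A))
              open EvenWalk s s∈A r len≡
              (b , b-exposed , b∉Sᵢ , last-b) = escape (walk s J) last-position last∈S₀
          in extended-path b b-exposed b∉Sᵢ last-b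

  centre : ∀ a → lab a ≡ i → ∀ b → lab b ≢ Fin.zero → lab b ≢ i → ∃ GoodCentre
  centre a a∈Sᵢ b b-exposed b∉Sᵢ = by-parity (even (count Sᵢ?)) refl
    where
      by-parity : ∀ e → even (count Sᵢ?) ≡ e → ∃ GoodCentre
      by-parity true σ-even = a , (λ a∈S₀ → i≢0 (trans (sym a∈Sᵢ) a∈S₀)) ,
        parity-pred (count (Sᵢ? without a)) (trans (cong even (sym (count-remove Sᵢ? a∈Sᵢ))) σ-even)
      by-parity false σ-odd = b , b-exposed , trans (cong even b-irrelevant) σ-odd
        where
          b-irrelevant : count (Sᵢ? without b) ≡ count Sᵢ?
          b-irrelevant = count-cong (Sᵢ? without b) Sᵢ? (λ _ → proj₁)
                           (λ v v∈Sᵢ → v∈Sᵢ , λ v≡b → b∉Sᵢ (subst (λ u → lab u ≡ i) v≡b v∈Sᵢ))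

  -- On a cycle of odd length take suc a = n: N leaves only the centre c unmatched,
  -- so both side conditions of augmenting-path hold vacuously.
  odd-cycle : even n ≡ false → ∀ c → GoodCentre c → AugmentingFromSᵢ
  odd-cycle n-odd c (c-exposed , odd) =
    R.augmenting-path (trans (cong even (R.A-count (λ v at-n → ⊥-elim (beyond v at-n)))) odd)
                      (λ y at-n → ⊥-elim (beyond y at-n))
    where
      module R = Reference c c-exposed m (parity-pred m n-odd) ≤-refl
                   (subst (λ x → even x ≡ true) (sym (m≤n⇒m∸n≡0 (n≤1+n m))) refl)
      beyond : ∀ v → pos c v ≢ n
      beyond v at-n = <-irrefl at-n (pos<n c v)

  -- On a cycle of even length, the second unmatched vertex is b if its position D
  -- relative to c is odd, and the vertex z after b otherwise; in the latter case, if
  -- z ∈ S_i, the cycle edge z b is already an augmenting path.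
  even-cycle : even n ≡ true → ∀ c → GoodCentre c → ∀ b → lab b ≢ Fin.zero → lab b ≢ i → AugmentingFromSᵢ
  even-cycle n-even c (c-exposed , odd) b b-exposed b∉Sᵢ = place (pos c b) refl
    where
      b-marked : ∀ a → pos c b ≡ suc a → even a ≡ true → AugmentingFromSᵢ
      b-marked a b-at a-even = R.augmenting-path (trans (cong even (R.A-count L∉Sᵢ)) odd) escape
        where
          module R = Reference c c-exposed a a-even (<⇒≤ (subst (_< n) b-at (pos<n c b)))
                       (even-∸ n (suc (suc a)) (trans n-even (sym a-even)))
          is-b : ∀ {v} → pos c v ≡ suc a → v ≡ b
          is-b at-L = pos-injective c (trans at-L (sym b-at))
          L∉Sᵢ : ∀ v → pos c v ≡ suc a → lab v ≢ i
          L∉Sᵢ v at-L v∈Sᵢ = b∉Sᵢ (subst (λ u → lab u ≡ i) (is-b at-L) v∈Sᵢ)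
          escape : ∀ y → pos c y ≡ suc a → lab y ≡ Fin.zero → HasExit y
          escape y at-L y∈S₀ = ⊥-elim (b-exposed (subst (λ u → lab u ≡ Fin.zero) (is-b at-L) y∈S₀))

      z : Fin n
      z = vertexAt c (suc (pos c b))

      z-b : CycAdj n z b
      z-b = adjacent-sym (subst (λ u → CycAdj n u z) (vertexAt-pos c b) (consecutive-adjacent c (pos c b)))

      successor-marked : even (pos c b) ≡ true → AugmentingFromSᵢ
      successor-marked D-even with lab z ≟ᶠ i
      ... | yes z∈Sᵢ = single-edge z b z-b z∈Sᵢ b-exposed b∉Sᵢ
      ... | no z∉Sᵢ = R.augmenting-path (trans (cong even (R.A-count L∉Sᵢ)) odd) escape
        where
          D = pos c b
          module R = Reference c c-exposed D D-even (pos<n c b)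
                       (even-∸ n (suc (suc D)) (trans n-even (sym D-even)))
          L∉Sᵢ : ∀ v → pos c v ≡ suc D → lab v ≢ i
          L∉Sᵢ v at-L v∈Sᵢ = z∉Sᵢ (subst (λ u → lab u ≡ i) (at-position c at-L) v∈Sᵢ)
          escape : ∀ y → pos c y ≡ suc D → lab y ≡ Fin.zero → HasExit y
          escape y at-L _ = b , b-exposed , b∉Sᵢ , subst (λ u → CycAdj n u b) (sym (at-position c at-L)) z-b

      place : ∀ D → pos c b ≡ D → AugmentingFromSᵢ
      place D b-at with even D in D-parity
      ... | true = successor-marked (trans (cong even b-at) D-parity)
      place (suc a) b-at | false = b-marked a b-at (parity-pred a D-parity)

  augmenting-path-exists : ∀ a → lab a ≡ i → ∀ b → lab b ≢ Fin.zero → lab b ≢ i → AugmentingFromSᵢ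
  augmenting-path-exists a a∈Sᵢ b b-exposed b∉Sᵢ with centre a a∈Sᵢ b b-exposed b∉Sᵢ | even n in n-parity
  ... | c , good | false = odd-cycle n-parity c good
  ... | c , good | true = even-cycle n-parity c good b b-exposed b∉Sᵢ

another-class : ∀ {k} (i : Fin (suc k)) → 2 ≤ k → ∃ λ j → j ≢ Fin.zero × j ≢ i
another-class {suc zero} _ (s≤s ())
another-class {suc (suc k)} Fin.zero _ = Fin.suc Fin.zero , (λ ()) , (λ ())
another-class {suc (suc k)} (Fin.suc Fin.zero) _ = Fin.suc (Fin.suc Fin.zero) , (λ ()) , (λ ())
another-class {suc (suc k)} (Fin.suc (Fin.suc _)) _ = Fin.suc Fin.zero , (λ ()) , (λ ())

-- The theorem.
lemma1 : (n k : ℕ) → 3 ≤ n → 2 ≤ k →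
    (lab : Fin n → Fin (suc k)) →
    ((i : Fin (suc k)) → i ≢ Fin.zero → ∃ λ v → lab v ≡ i) →
    (∃ λ h → sizeS₀ lab ≡ 2 * h) →
    (μ : Fin n → Fin n) → IsPerfectMatchingOn lab μ →
    (i : Fin (suc k)) → i ≢ Fin.zero →
    ∃ λ r → ∃ λ (p : ℕ → Fin n) →
    IsAugPath n k lab μ r p
    × (lab (p 0) ≡ i)
    × (lab (p (2 * r + 1)) ≢ i)
lemma1 (suc m) k _ 2≤k lab onto _ μ μ-perfect i i≢0 =
  let (a , a∈Sᵢ) = onto i i≢0
      (j , j≢0 , j≢i) = another-class i 2≤k
      (b , b∈Sⱼ) = onto j j≢0
  in augmenting-path-exists a a∈Sᵢ b (λ b∈S₀ → j≢0 (trans (sym b∈Sⱼ) b∈S₀))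
                                     (λ b∈Sᵢ → j≢i (trans (sym b∈Sⱼ) b∈Sᵢ))
  where open Construction m k lab μ μ-perfect i i≢0
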